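{- If $G$ is a König–Egerváry graph, then both $\mathrm{core}(G)$ and $\mathrm{corona}(G)$ are critical sets of $G$.
   Context: $G$ is a finite simple graph. For $X\subseteq V(G)$, $N(X)=\{v\in V(G): N(v)\cap X\neq\emptyset\}$, $d(X)=|X|-|N(X)|$, and $d(G)=\max\{d(X):X\subseteq V(G)\}$; $X$ is a critical set if $d(X)=d(G)$. $\alpha(G)$ is the independence number, $\mu(G)$ the maximum matching size, and $\Omega(G)$ the family of maximum independent sets. $\mathrm{core}(G)=\bigcap\{S:S\in\Omega(G)\}$ and $\mathrm{corona}(G)=\bigcup\{S:S\in\Omega(G)\}$. $G$ is a König–Egerváry graph if $\alpha(G)+\mu(G)=|V(G)|$. -}

module Defs where

open import Data.Nat using (ℕ; zero; suc; _+_; _≤_)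
open import Data.Bool using (Bool; true; false; _∧_; _∨_)
open import Data.Fin using (Fin; zero; suc)
open import Data.Fin.Subset using (Subset; _∈_; ∣_∣)
open import Data.Vec using (tabulate)
open import Data.List using (List; []; _∷_; length)
open import Data.List.Relation.Unary.All using (All)
open import Data.List.Relation.Unary.Unique.Propositional using (Unique)
open import Data.Product using (_×_; Σ; ∃; _,_)
open import Function.Bundles using (_⇔_)
open import Relation.Binary.PropositionalEquality using (_≡_)

record Graph (n : ℕ) : Set where
  field
    adj   : Fin n → Fin n → Bool
    sym   : ∀ u v → adj u v ≡ adj v u
    irrefl : ∀ v → adj v v ≡ false
open Graph public

anyFin : ∀ {n} → (Fin n → Bool) → Bool
anyFin {zero}  f = false
anyFin {suc n} f = f zero ∨ anyFin (λ i → f (suc i))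

memb : ∀ {n} → Subset n → Fin n → Bool
memb X i = Data.Vec.lookup X i
  where import Data.Vec

N : ∀ {n} → Graph n → Subset n → Subset n
N G X = tabulate (λ v → anyFin (λ u → memb X u ∧ adj G v u))

-- X is critical: d(X) = d(G) = max_Y d(Y), where d(Y) = |Y| - |N(Y)|.
-- "d(Y) ≤ d(X)" is written over ℕ as |Y| + |N(X)| ≤ |X| + |N(Y)|.
Critical : ∀ {n} → Graph n → Subset n → Set
Critical G X = ∀ Y → ∣ Y ∣ + ∣ N G X ∣ ≤ ∣ X ∣ + ∣ N G Y ∣

Independent : ∀ {n} → Graph n → Subset n → Set
Independent G S = ∀ u v → u ∈ S → v ∈ S → adj G u v ≡ false

MaxIndependent : ∀ {n} → Graph n → Subset n → Set
MaxIndependent G S = Independent G S × (∀ T → Independent G T → ∣ T ∣ ≤ ∣ S ∣)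

IsIndependenceNumber : ∀ {n} → Graph n → ℕ → Set
IsIndependenceNumber G a = Σ (Subset _) λ S → MaxIndependent G S × ∣ S ∣ ≡ a

endpoints : ∀ {n} → List (Fin n × Fin n) → List (Fin n)
endpoints [] = []
endpoints ((u , v) ∷ es) = u ∷ v ∷ endpoints es

Matching : ∀ {n} → Graph n → List (Fin n × Fin n) → Set
Matching G M = All (λ { (u , v) → adj G u v ≡ true }) M × Unique (endpoints M)

IsMatchingNumber : ∀ {n} → Graph n → ℕ → Set
IsMatchingNumber G m =
  Σ (List _) λ M → Matching G M × length M ≡ m
    × (∀ M′ → Matching G M′ → length M′ ≤ m)

KoenigEgervary : ∀ {n} → Graph n → Set
KoenigEgervary {n} G =
  ∃ λ a → ∃ λ m → IsIndependenceNumber G a × IsMatchingNumber G m × a + m ≡ n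

IsCore : ∀ {n} → Graph n → Subset n → Set
IsCore G X = ∀ v → (v ∈ X) ⇔ (∀ S → MaxIndependent G S → v ∈ S)

IsCorona : ∀ {n} → Graph n → Subset n → Set
IsCorona G X = ∀ v → (v ∈ X) ⇔ (∃ λ S → MaxIndependent G S × v ∈ S)

-- Write d(X) = |X| − |N(X)|. For every matching M and every X, d(X) ≤ n − 2|M|: a
-- matched vertex of X puts its partner into N(X), and at most n − 2|M| vertices are
-- unmatched. If α + μ = n, a maximum independent set S is disjoint from N(S), so
-- |N(S)| ≤ n − α = μ and d(S) ≥ n − 2μ: every maximum independent set is critical.
-- Since N(A ∪ B) = N(A) ∪ N(B) and N(A ∩ B) ⊆ N(A) ∩ N(B), d is supermodular, so
-- critical sets are closed under ∪ and ∩; core and corona are the intersection and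
-- the union of the finitely many maximum independent sets.
module Submission where

open import Data.Nat.Base using (ℕ; zero; suc; _+_; _≤_; z≤n)
open import Data.Nat.Properties
open import Data.Nat.ListAction using () renaming (sum to sumₗ)
open import Data.Nat.Tactic.RingSolver using (solve-∀)
open import Algebra.Properties.CommutativeSemigroup +-commutativeSemigroup
  using (interchange; x∙yz≈y∙xz; xy∙z≈xz∙y)
open import Algebra.Properties.Monoid.Sum +-0-monoid using (sum)
open import Data.Bool.Base using (Bool; true; false; _∧_)
import Data.Bool.Properties as Bool
open import Data.Empty using (⊥-elim)
open import Data.Fin.Base using (Fin; zero; suc)
open import Data.Fin.Properties using (all?)
open import Data.Fin.Subset
  using (Subset; inside; outside; _∈_; _∉_; _⊆_; ∣_∣; _∩_; _∪_; ⊥)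
open import Data.Fin.Subset.Properties
  using (_∈?_; ⊆-antisym; p⊆q⇒∣p∣≤∣q∣; ∣p∣≤n; ∣⊥∣≡0; p∩q⊆p; p∩q⊆q;
         x∈p∩q⁺; x∈p∩q⁻; x∈p∪q⁺; x∈p∪q⁻)
open import Data.List.Base using (List; []; _∷_; [_]; length; map; foldr; filter; _++_)
open import Data.List.Properties
  using (map-cong-local; foldr-preservesᵇ; foldr-preservesᵒ; foldr-forcesᵇ)
open import Data.List.Membership.Propositional using (find; lose) renaming (_∈_ to _∈ₗ_)
open import Data.List.Membership.Propositional.Properties
  using (∈-map⁺; ∈-++⁺ˡ; ∈-++⁺ʳ; ∈-filter⁺; ∈-filter⁻)
open import Data.List.Relation.Unary.All as All using (All; []; _∷_)
open import Data.List.Relation.Unary.Any using (Any; here; there)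
open import Data.List.Relation.Unary.AllPairs using (_∷_)
open import Data.List.Relation.Unary.Unique.Propositional using (Unique)
open import Data.Product using (_×_; ∃; _,_; proj₁; proj₂)
open import Data.Sum as Sum using (_⊎_; inj₁; inj₂)
open import Data.Vec.Base using ([]; _∷_)
open import Data.Vec.Properties using (lookup∘tabulate; []=⇒lookup; lookup⇒[]=)
open import Data.Vec.Functional using (Vector; updateAt; tail)
open import Data.Vec.Functional.Properties using (updateAt-minimal)
open import Data.Vec.Functional.Relation.Binary.Pointwise using (Pointwise)
open import Function.Base using (_∘_; const)
open import Function.Bundles using (Equivalence)
open import Relation.Binary.PropositionalEquality
  using (_≡_; refl; sym; trans; cong; cong₂; subst; subst₂; ≢-sym; module ≡-Reasoning)
open import Relation.Nullary.Decidable using (yes; no; does; map′; _×-dec_; _→-dec_)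
open import Relation.Unary using (Decidable)
open import Defs hiding (sym)

𝟙 : Bool → ℕ
𝟙 true  = 1
𝟙 false = 0

χ : ∀ {n} → Subset n → Vector ℕ n
χ p i = 𝟙 (does (i ∈? p))

χ≤1 : ∀ {n} (p : Subset n) i → χ p i ≤ 1
χ≤1 p i with does (i ∈? p)
... | true  = ≤-refl
... | false = z≤n

χ-≤ : ∀ {n} {p q : Subset n} {i j} → (i ∈ p → j ∈ q) → χ p i ≤ χ q j
χ-≤ {p = p} {q} {i} {j} i∈p⇒j∈q with i ∈? p | j ∈? q
... | no  _   | _       = z≤n
... | yes _   | yes _   = ≤-refl
... | yes i∈p | no  j∉q = ⊥-elim (j∉q (i∈p⇒j∈q i∈p))

∣p∣≡∑χ : ∀ {n} (p : Subset n) → ∣ p ∣ ≡ sum (χ p)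
∣p∣≡∑χ []            = refl
∣p∣≡∑χ (inside  ∷ p) = cong suc (∣p∣≡∑χ p)
∣p∣≡∑χ (outside ∷ p) = ∣p∣≡∑χ p

∑-mono-≤ : ∀ {n} {f g : Vector ℕ n} → Pointwise _≤_ f g → sum f ≤ sum g
∑-mono-≤ {zero}  _   = z≤n
∑-mono-≤ {suc n} f≤g = +-mono-≤ (f≤g zero) (∑-mono-≤ (f≤g ∘ suc))

∑1≡n : ∀ n → sum {n} (const 1) ≡ n
∑1≡n zero    = refl
∑1≡n (suc n) = cong suc (∑1≡n n)

vanishAt : ∀ {n} → Fin n → Vector ℕ n → Vector ℕ n
vanishAt i f = updateAt f i (const 0)

vanishOn : ∀ {n} → List (Fin n) → Vector ℕ n → Vector ℕ n
vanishOn []       f = f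
vanishOn (i ∷ is) f = vanishOn is (vanishAt i f)

∑-vanishAt : ∀ {n} (i : Fin n) (f : Vector ℕ n) → sum f ≡ f i + sum (vanishAt i f)
∑-vanishAt zero    f = refl
∑-vanishAt (suc i) f =
  trans (cong (f zero +_) (∑-vanishAt i (tail f)))
        (x∙yz≈y∙xz (f zero) (f (suc i)) (sum (vanishAt i (tail f))))

vanishAt-mono : ∀ {n} (i : Fin n) {f g : Vector ℕ n} →
  Pointwise _≤_ f g → Pointwise _≤_ (vanishAt i f) (vanishAt i g)
vanishAt-mono zero    f≤g zero    = z≤n
vanishAt-mono zero    f≤g (suc j) = f≤g (suc j)
vanishAt-mono (suc i) f≤g zero    = f≤g zero
vanishAt-mono (suc i) f≤g (suc j) = vanishAt-mono i (f≤g ∘ suc) j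

vanishOn-mono : ∀ {n} (is : List (Fin n)) {f g : Vector ℕ n} →
  Pointwise _≤_ f g → Pointwise _≤_ (vanishOn is f) (vanishOn is g)
vanishOn-mono []       f≤g = f≤g
vanishOn-mono (i ∷ is) f≤g = vanishOn-mono is (vanishAt-mono i f≤g)

∑-split : ∀ {n} {is : List (Fin n)} → Unique is → (f : Vector ℕ n) →
  sum f ≡ sum (vanishOn is f) + sumₗ (map f is)
∑-split {is = []}     _                f = sym (+-identityʳ (sum f))
∑-split {is = i ∷ is} (i∉is ∷ is-uniq) f = begin
  sum f                                               ≡⟨ ∑-vanishAt i f ⟩
  f i + sum f′                                        ≡⟨ cong (f i +_) (∑-split is-uniq f′) ⟩
  f i + (sum (vanishOn is f′) + sumₗ (map f′ is))
    ≡⟨ cong (λ s → f i + (sum (vanishOn is f′) + sumₗ s)) f′≡f-on-is ⟩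
  f i + (sum (vanishOn is f′) + sumₗ (map f is))      ≡⟨ x∙yz≈y∙xz (f i) (sum (vanishOn is f′)) _ ⟩
  sum (vanishOn is f′) + (f i + sumₗ (map f is))      ∎
  where
  open ≡-Reasoning
  f′ = vanishAt i f
  f′≡f-on-is : map f′ is ≡ map f is
  f′≡f-on-is = map-cong-local (All.map (λ i≢j → updateAt-minimal _ i f (≢-sym i≢j)) i∉is)

sumₗ-distinct≤∑ : ∀ {n} {is : List (Fin n)} → Unique is → (f : Vector ℕ n) →
  sumₗ (map f is) ≤ sum f
sumₗ-distinct≤∑ is-uniq f = ≤-trans (m≤n+m _ _) (≤-reflexive (sym (∑-split is-uniq f)))

∑+sumₗ-distinct-exchange : ∀ {n} {is : List (Fin n)} → Unique is → {f g : Vector ℕ n} →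
  Pointwise _≤_ f g → sum f + sumₗ (map g is) ≤ sum g + sumₗ (map f is)
∑+sumₗ-distinct-exchange {is = is} is-uniq {f} {g} f≤g = begin
  sum f + G                         ≡⟨ cong (_+ G) (∑-split is-uniq f) ⟩
  sum (vanishOn is f) + F + G       ≤⟨ +-monoˡ-≤ G (+-monoˡ-≤ F (∑-mono-≤ (vanishOn-mono is f≤g))) ⟩
  sum (vanishOn is g) + F + G       ≡⟨ xy∙z≈xz∙y (sum (vanishOn is g)) F G ⟩
  sum (vanishOn is g) + G + F       ≡⟨ cong (_+ F) (∑-split is-uniq g) ⟨
  sum g + F                         ∎
  where
  open ≤-Reasoning
  F = sumₗ (map f is)
  G = sumₗ (map g is)

-- A pair (s , t) stands for the integer s − t; _≼_ is the order of these differences.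
infix  4 _≼_
infixl 6 _⊕_

_≼_ : ℕ × ℕ → ℕ × ℕ → Set
(s , t) ≼ (s′ , t′) = s + t′ ≤ s′ + t

_⊕_ : ℕ × ℕ → ℕ × ℕ → ℕ × ℕ
(s , t) ⊕ (s′ , t′) = s + s′ , t + t′

⊕-comm : ∀ p q → p ⊕ q ≡ q ⊕ p
⊕-comm (s , t) (s′ , t′) = cong₂ _,_ (+-comm s s′) (+-comm t t′)

≼-trans : ∀ p q r → p ≼ q → q ≼ r → p ≼ r
≼-trans (s₁ , t₁) (s₂ , t₂) (s₃ , t₃) p≼q q≼r = +-cancelʳ-≤ (s₂ + t₂) _ _ (begin
  s₁ + t₃ + (s₂ + t₂)     ≡⟨ rearrangeˡ s₁ t₂ s₂ t₃ ⟩
  s₁ + t₂ + (s₂ + t₃)     ≤⟨ +-mono-≤ p≼q q≼r ⟩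
  s₂ + t₁ + (s₃ + t₂)     ≡⟨ rearrangeʳ s₂ t₁ s₃ t₂ ⟩
  s₃ + t₁ + (s₂ + t₂)     ∎)
  where
  open ≤-Reasoning
  rearrangeˡ : ∀ a b c d → a + d + (c + b) ≡ a + b + (c + d)
  rearrangeˡ = solve-∀
  rearrangeʳ : ∀ a b c d → a + b + (c + d) ≡ c + b + (a + d)
  rearrangeʳ = solve-∀

⊕-monoʳ-≼ : ∀ p q r → q ≼ r → p ⊕ q ≼ p ⊕ r
⊕-monoʳ-≼ (s , t) (s₁ , t₁) (s₂ , t₂) q≼r = begin
  s + s₁ + (t + t₂)    ≡⟨ interchange s s₁ t t₂ ⟩
  s + t + (s₁ + t₂)    ≤⟨ +-monoʳ-≤ (s + t) q≼r ⟩
  s + t + (s₂ + t₁)    ≡⟨ interchange s t s₂ t₁ ⟩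
  s + s₂ + (t + t₁)    ∎
  where open ≤-Reasoning

⊕-cancelʳ-≼ : ∀ p q r → p ⊕ r ≼ q ⊕ r → p ≼ q
⊕-cancelʳ-≼ (s₁ , t₁) (s₂ , t₂) (s , t) le = +-cancelʳ-≤ (s + t) _ _ (begin
  s₁ + t₂ + (s + t)    ≡⟨ interchange s₁ s t₂ t ⟨
  s₁ + s + (t₂ + t)    ≤⟨ le ⟩
  s₂ + s + (t₁ + t)    ≡⟨ interchange s₂ s t₁ t ⟩
  s₂ + t₁ + (s + t)    ∎)
  where open ≤-Reasoning

∣p∪q∣+∣p∩q∣≡∣p∣+∣q∣ : ∀ {n} (p q : Subset n) → ∣ p ∪ q ∣ + ∣ p ∩ q ∣ ≡ ∣ p ∣ + ∣ q ∣
∣p∪q∣+∣p∩q∣≡∣p∣+∣q∣ []            []            = refl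
∣p∪q∣+∣p∩q∣≡∣p∣+∣q∣ (outside ∷ p) (outside ∷ q) = ∣p∪q∣+∣p∩q∣≡∣p∣+∣q∣ p q
∣p∪q∣+∣p∩q∣≡∣p∣+∣q∣ (inside  ∷ p) (outside ∷ q) = cong suc (∣p∪q∣+∣p∩q∣≡∣p∣+∣q∣ p q)
∣p∪q∣+∣p∩q∣≡∣p∣+∣q∣ (outside ∷ p) (inside  ∷ q) =
  trans (cong suc (∣p∪q∣+∣p∩q∣≡∣p∣+∣q∣ p q)) (sym (+-suc ∣ p ∣ ∣ q ∣))
∣p∪q∣+∣p∩q∣≡∣p∣+∣q∣ (inside  ∷ p) (inside  ∷ q) = cong suc (begin
  ∣ p ∪ q ∣ + suc ∣ p ∩ q ∣   ≡⟨ +-suc ∣ p ∪ q ∣ ∣ p ∩ q ∣ ⟩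
  suc (∣ p ∪ q ∣ + ∣ p ∩ q ∣) ≡⟨ cong suc (∣p∪q∣+∣p∩q∣≡∣p∣+∣q∣ p q) ⟩
  suc (∣ p ∣ + ∣ q ∣)         ≡⟨ +-suc ∣ p ∣ ∣ q ∣ ⟨
  ∣ p ∣ + suc ∣ q ∣           ∎)
  where open ≡-Reasoning

disjoint⇒∣p∣+∣q∣≤n : ∀ {n} {p q : Subset n} → (∀ {x} → x ∈ p → x ∉ q) → ∣ p ∣ + ∣ q ∣ ≤ n
disjoint⇒∣p∣+∣q∣≤n {n} {p} {q} disjoint = begin
  ∣ p ∣ + ∣ q ∣           ≡⟨ ∣p∪q∣+∣p∩q∣≡∣p∣+∣q∣ p q ⟨
  ∣ p ∪ q ∣ + ∣ p ∩ q ∣   ≤⟨ +-mono-≤ (∣p∣≤n (p ∪ q)) (p⊆q⇒∣p∣≤∣q∣ p∩q⊆⊥) ⟩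
  n + ∣ ⊥ {n} ∣           ≡⟨ cong (n +_) (∣⊥∣≡0 n) ⟩
  n + 0                   ≡⟨ +-identityʳ n ⟩
  n                       ∎
  where
  open ≤-Reasoning
  p∩q⊆⊥ : p ∩ q ⊆ ⊥
  p∩q⊆⊥ x∈p∩q = let x∈p , x∈q = x∈p∩q⁻ p q x∈p∩q in ⊥-elim (disjoint x∈p x∈q)

anyFin⁺ : ∀ {n} (f : Fin n → Bool) i → f i ≡ true → anyFin f ≡ true
anyFin⁺ f zero    fi≡true rewrite fi≡true = refl
anyFin⁺ f (suc i) fi≡true rewrite anyFin⁺ (f ∘ suc) i fi≡true = Bool.∨-zeroʳ (f zero)

anyFin⁻ : ∀ {n} (f : Fin n → Bool) → anyFin f ≡ true → ∃ λ i → f i ≡ true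
anyFin⁻ {suc n} f any≡true with f zero in f0≡
... | true  = zero , f0≡
... | false = let i , fi≡true = anyFin⁻ (f ∘ suc) any≡true in suc i , fi≡true

∧≡true⁻ : ∀ {a b} → a ∧ b ≡ true → a ≡ true × b ≡ true
∧≡true⁻ {true} {true} _ = refl , refl

sumₗ-endpoints-1 : ∀ {n} (M : List (Fin n × Fin n)) →
  sumₗ (map (const 1) (endpoints M)) ≡ length M + length M
sumₗ-endpoints-1 []      = refl
sumₗ-endpoints-1 (_ ∷ M) =
  cong suc (trans (cong suc (sumₗ-endpoints-1 M)) (sym (+-suc (length M) (length M))))

allSubsets : ∀ n → List (Subset n)
allSubsets zero    = [ [] ]
allSubsets (suc n) = map (outside ∷_) (allSubsets n) ++ map (inside ∷_) (allSubsets n)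

∈-allSubsets : ∀ {n} (p : Subset n) → p ∈ₗ allSubsets n
∈-allSubsets []            = here refl
∈-allSubsets (outside ∷ p) = ∈-++⁺ˡ (∈-map⁺ (outside ∷_) (∈-allSubsets p))
∈-allSubsets (inside  ∷ p) = ∈-++⁺ʳ _ (∈-map⁺ (inside ∷_) (∈-allSubsets p))

∈-foldr-∪⁻ : ∀ {n} {x : Fin n} {s} ps → x ∈ foldr _∪_ s ps → x ∈ s ⊎ Any (x ∈_) ps
∈-foldr-∪⁻ []       x∈s = inj₁ x∈s
∈-foldr-∪⁻ (p ∷ ps) x∈p∪rest with x∈p∪q⁻ p _ x∈p∪rest
... | inj₁ x∈p    = inj₂ (here x∈p)
... | inj₂ x∈rest = Sum.map₂ there (∈-foldr-∪⁻ ps x∈rest)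

module _ {n} (G : Graph n) where

  ∈N⁺ : ∀ {X u v} → u ∈ X → adj G v u ≡ true → v ∈ N G X
  ∈N⁺ {X} {u} {v} u∈X vu = lookup⇒[]= v (N G X)
    (trans (lookup∘tabulate _ v) (anyFin⁺ _ u (cong₂ _∧_ ([]=⇒lookup u∈X) vu)))

  ∈N⁻ : ∀ {X v} → v ∈ N G X → ∃ λ u → u ∈ X × adj G v u ≡ true
  ∈N⁻ {X} {v} v∈NX =
    let u , found = anyFin⁻ _ (trans (sym (lookup∘tabulate _ v)) ([]=⇒lookup v∈NX))
        u∈X , vu = ∧≡true⁻ found
    in u , lookup⇒[]= u X u∈X , vu

  N-mono : ∀ {A B} → A ⊆ B → N G A ⊆ N G B
  N-mono A⊆B v∈NA = let u , u∈A , vu = ∈N⁻ v∈NA in ∈N⁺ (A⊆B u∈A) vu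

  N-∪ : ∀ A B → N G (A ∪ B) ⊆ N G A ∪ N G B
  N-∪ A B v∈N[A∪B] with ∈N⁻ v∈N[A∪B]
  ... | u , u∈A∪B , vu with x∈p∪q⁻ A B u∈A∪B
  ...   | inj₁ u∈A = x∈p∪q⁺ (inj₁ (∈N⁺ u∈A vu))
  ...   | inj₂ u∈B = x∈p∪q⁺ (inj₂ (∈N⁺ u∈B vu))

  N-∩ : ∀ A B → N G (A ∩ B) ⊆ N G A ∩ N G B
  N-∩ A B v∈N[A∩B] = x∈p∩q⁺ (N-mono (p∩q⊆p A B) v∈N[A∩B] , N-mono (p∩q⊆q A B) v∈N[A∩B])

  ∣N∪∣+∣N∩∣≤∣N∣+∣N∣ : ∀ A B → ∣ N G (A ∪ B) ∣ + ∣ N G (A ∩ B) ∣ ≤ ∣ N G A ∣ + ∣ N G B ∣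
  ∣N∪∣+∣N∩∣≤∣N∣+∣N∣ A B = begin
    ∣ N G (A ∪ B) ∣ + ∣ N G (A ∩ B) ∣
      ≤⟨ +-mono-≤ (p⊆q⇒∣p∣≤∣q∣ (N-∪ A B)) (p⊆q⇒∣p∣≤∣q∣ (N-∩ A B)) ⟩
    ∣ N G A ∪ N G B ∣ + ∣ N G A ∩ N G B ∣
      ≡⟨ ∣p∪q∣+∣p∩q∣≡∣p∣+∣q∣ (N G A) (N G B) ⟩
    ∣ N G A ∣ + ∣ N G B ∣
      ∎
    where open ≤-Reasoning

  δ : Subset n → ℕ × ℕ
  δ X = ∣ X ∣ , ∣ N G X ∣

  δ-supermodular : ∀ A B → δ A ⊕ δ B ≼ δ (A ∪ B) ⊕ δ (A ∩ B)
  δ-supermodular A B = begin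
    ∣ A ∣ + ∣ B ∣ + (∣ N G (A ∪ B) ∣ + ∣ N G (A ∩ B) ∣)
      ≤⟨ +-monoʳ-≤ (∣ A ∣ + ∣ B ∣) (∣N∪∣+∣N∩∣≤∣N∣+∣N∣ A B) ⟩
    ∣ A ∣ + ∣ B ∣ + (∣ N G A ∣ + ∣ N G B ∣)
      ≡⟨ cong (_+ (∣ N G A ∣ + ∣ N G B ∣)) (∣p∪q∣+∣p∩q∣≡∣p∣+∣q∣ A B) ⟨
    ∣ A ∪ B ∣ + ∣ A ∩ B ∣ + (∣ N G A ∣ + ∣ N G B ∣)
      ∎
    where open ≤-Reasoning

  Critical-∪ : ∀ {A B} → Critical G A → Critical G B → Critical G (A ∪ B)
  Critical-∪ {A} {B} A-crit B-crit Y = ≼-trans (δ Y) (δ A) (δ (A ∪ B)) (A-crit Y)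
    (⊕-cancelʳ-≼ (δ A) (δ (A ∪ B)) (δ B)
      (≼-trans (δ A ⊕ δ B) (δ (A ∪ B) ⊕ δ (A ∩ B)) (δ (A ∪ B) ⊕ δ B)
        (δ-supermodular A B) (⊕-monoʳ-≼ (δ (A ∪ B)) (δ (A ∩ B)) (δ B) (B-crit (A ∩ B)))))

  Critical-∩ : ∀ {A B} → Critical G A → Critical G B → Critical G (A ∩ B)
  Critical-∩ {A} {B} A-crit B-crit Y = ≼-trans (δ Y) (δ B) (δ (A ∩ B)) (B-crit Y)
    (⊕-cancelʳ-≼ (δ B) (δ (A ∩ B)) (δ A)
      (≼-trans (δ B ⊕ δ A) (δ (A ∩ B) ⊕ δ (A ∪ B)) (δ (A ∩ B) ⊕ δ A)
        (subst₂ _≼_ (⊕-comm (δ A) (δ B)) (⊕-comm (δ (A ∪ B)) (δ (A ∩ B))) (δ-supermodular A B))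
        (⊕-monoʳ-≼ (δ (A ∩ B)) (δ (A ∪ B)) (δ A) (A-crit (A ∪ B)))))

  sumₗ-endpoints-≤ : ∀ {f g : Vector ℕ n} → (∀ {u v} → adj G u v ≡ true → f u ≤ g v) →
    ∀ {M} → Matching G M → sumₗ (map f (endpoints M)) ≤ sumₗ (map g (endpoints M))
  sumₗ-endpoints-≤ f≤g {[]} _ = z≤n
  sumₗ-endpoints-≤ {f} {g} f≤g {(u , v) ∷ M} (uv ∷ edges , _ ∷ _ ∷ uniq) = begin
    f u + (f v + sumₗ (map f (endpoints M)))   ≤⟨ +-mono-≤ (f≤g uv) (+-mono-≤ (f≤g vu) rest) ⟩
    g v + (g u + sumₗ (map g (endpoints M)))   ≡⟨ x∙yz≈y∙xz (g v) (g u) _ ⟩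
    g u + (g v + sumₗ (map g (endpoints M)))   ∎
    where
    open ≤-Reasoning
    vu = trans (Graph.sym G v u) uv
    rest = sumₗ-endpoints-≤ f≤g (edges , uniq)

  matching-bound : ∀ {M} → Matching G M → ∀ Y → δ Y ≼ (n , length M + length M)
  matching-bound {M} M-matching@(_ , uniq) Y = begin
    ∣ Y ∣ + (length M + length M)              ≡⟨ cong₂ _+_ (∣p∣≡∑χ Y) (sym (sumₗ-endpoints-1 M)) ⟩
    sum (χ Y) + sumₗ (map (const 1) es)        ≤⟨ ∑+sumₗ-distinct-exchange uniq {g = const 1} (χ≤1 Y) ⟩
    sum {n} (const 1) + sumₗ (map (χ Y) es)    ≡⟨ cong (_+ sumₗ (map (χ Y) es)) (∑1≡n n) ⟩
    n + sumₗ (map (χ Y) es)                    ≤⟨ +-monoʳ-≤ n (sumₗ-endpoints-≤ χY≤χNY M-matching) ⟩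
    n + sumₗ (map (χ (N G Y)) es)              ≤⟨ +-monoʳ-≤ n (sumₗ-distinct≤∑ uniq (χ (N G Y))) ⟩
    n + sum (χ (N G Y))                        ≡⟨ cong (n +_) (∣p∣≡∑χ (N G Y)) ⟨
    n + ∣ N G Y ∣                              ∎
    where
    open ≤-Reasoning
    es = endpoints M
    χY≤χNY : ∀ {u v} → adj G u v ≡ true → χ Y u ≤ χ (N G Y) v
    χY≤χNY {u} {v} uv = χ-≤ (λ u∈Y → ∈N⁺ u∈Y (trans (Graph.sym G v u) uv))

  N-disjoint : ∀ {S} → Independent G S → ∀ {v} → v ∈ N G S → v ∉ S
  N-disjoint S-indep {v} v∈NS v∈S =
    let u , u∈S , vu = ∈N⁻ v∈NS in Bool.not-¬ vu (S-indep v u v∈S u∈S)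

  independent-attains : ∀ {S} {M : List (Fin n × Fin n)} → Independent G S →
    ∣ S ∣ + length M ≡ n → (n , length M + length M) ≼ δ S
  independent-attains {S} {M} S-indep ∣S∣+∣M∣≡n = begin
    n + ∣ N G S ∣                 ≡⟨ cong (_+ ∣ N G S ∣) ∣S∣+∣M∣≡n ⟨
    ∣ S ∣ + m + ∣ N G S ∣         ≡⟨ +-assoc (∣ S ∣) m (∣ N G S ∣) ⟩
    ∣ S ∣ + (m + ∣ N G S ∣)       ≤⟨ +-monoʳ-≤ ∣ S ∣ (+-monoʳ-≤ m ∣NS∣≤m) ⟩
    ∣ S ∣ + (m + m)               ∎
    where
    open ≤-Reasoning
    m = length M
    ∣NS∣≤m : ∣ N G S ∣ ≤ m
    ∣NS∣≤m = +-cancelʳ-≤ (∣ S ∣) _ _ (begin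
      ∣ N G S ∣ + ∣ S ∣   ≤⟨ disjoint⇒∣p∣+∣q∣≤n (N-disjoint S-indep) ⟩
      n                   ≡⟨ ∣S∣+∣M∣≡n ⟨
      ∣ S ∣ + m           ≡⟨ +-comm (∣ S ∣) m ⟩
      m + ∣ S ∣           ∎)

  independent-critical : ∀ {S M} → Matching G M → Independent G S → ∣ S ∣ + length M ≡ n →
    Critical G S
  independent-critical {S} {M} M-matching S-indep ∣S∣+∣M∣≡n Y =
    ≼-trans (δ Y) (n , length M + length M) (δ S)
      (matching-bound M-matching Y) (independent-attains {M = M} S-indep ∣S∣+∣M∣≡n)

  Independent? : Decidable (Independent G)
  Independent? S = all? λ u → all? λ v →
    u ∈? S →-dec v ∈? S →-dec adj G u v Bool.≟ false

  maxIndependent-size : ∀ {S T} → MaxIndependent G S → MaxIndependent G T → ∣ S ∣ ≡ ∣ T ∣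
  maxIndependent-size (S-indep , S-max) (T-indep , T-max) =
    ≤-antisym (T-max _ S-indep) (S-max _ T-indep)

  MaxIndependent? : ∀ {S₀} → MaxIndependent G S₀ → Decidable (MaxIndependent G)
  MaxIndependent? {S₀} S₀-max@(_ , S₀-bound) T =
    map′ (λ (T-indep , ∣T∣≡∣S₀∣) → T-indep , λ U U-indep →
            subst (∣ U ∣ ≤_) (sym ∣T∣≡∣S₀∣) (S₀-bound U U-indep))
         (λ T-max → proj₁ T-max , maxIndependent-size T-max S₀-max)
         (Independent? T ×-dec ∣ T ∣ ≟ ∣ S₀ ∣)

  module _ {S₀} (S₀-max : MaxIndependent G S₀) where

    -- Folds over Ω are seeded with S₀ rather than ⊤ or ⊥ (as ⋂ and ⋃ are), so that every
    -- partial fold stays critical.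
    Ω : List (Subset n)
    Ω = filter (MaxIndependent? S₀-max) (allSubsets n)

    ∈Ω⁺ : ∀ {S} → MaxIndependent G S → S ∈ₗ Ω
    ∈Ω⁺ {S} = ∈-filter⁺ (MaxIndependent? S₀-max) (∈-allSubsets S)

    ∈Ω⁻ : ∀ {S} → S ∈ₗ Ω → MaxIndependent G S
    ∈Ω⁻ S∈Ω = proj₂ (∈-filter⁻ (MaxIndependent? S₀-max) {xs = allSubsets n} S∈Ω)

    core≡⋂Ω : ∀ {C} → IsCore G C → C ≡ foldr _∩_ S₀ Ω
    core≡⋂Ω {C} C-core = ⊆-antisym C⊆⋂Ω ⋂Ω⊆C
      where
      C⊆⋂Ω : C ⊆ foldr _∩_ S₀ Ω
      C⊆⋂Ω {v} v∈C = foldr-preservesᵇ (λ v∈p v∈q → x∈p∩q⁺ (v∈p , v∈q))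
        (in-all S₀ S₀-max) (All.tabulate (λ S∈Ω → in-all _ (∈Ω⁻ S∈Ω)))
        where in-all = Equivalence.to (C-core v) v∈C
      ⋂Ω⊆C : foldr _∩_ S₀ Ω ⊆ C
      ⋂Ω⊆C {v} v∈⋂Ω = Equivalence.from (C-core v) λ S S-max →
        All.lookup (foldr-forcesᵇ (λ p q → x∈p∩q⁻ p q) S₀ Ω v∈⋂Ω) (∈Ω⁺ S-max)

    corona≡⋃Ω : ∀ {K} → IsCorona G K → K ≡ foldr _∪_ S₀ Ω
    corona≡⋃Ω {K} K-corona = ⊆-antisym K⊆⋃Ω ⋃Ω⊆K
      where
      K⊆⋃Ω : K ⊆ foldr _∪_ S₀ Ω
      K⊆⋃Ω {v} v∈K = let S , S-max , v∈S = Equivalence.to (K-corona v) v∈K in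
        foldr-preservesᵒ {P = v ∈_} (λ p q → x∈p∪q⁺) S₀ Ω (inj₂ (lose (∈Ω⁺ S-max) v∈S))
      ⋃Ω⊆K : foldr _∪_ S₀ Ω ⊆ K
      ⋃Ω⊆K {v} v∈⋃Ω = Equivalence.from (K-corona v) (witness (∈-foldr-∪⁻ Ω v∈⋃Ω))
        where
        witness : v ∈ S₀ ⊎ Any (v ∈_) Ω → ∃ λ S → MaxIndependent G S × v ∈ S
        witness (inj₁ v∈S₀) = S₀ , S₀-max , v∈S₀
        witness (inj₂ v∈some) = let S , S∈Ω , v∈S = find v∈some in S , ∈Ω⁻ S∈Ω , v∈S

    module _ (Ω-critical : ∀ S → MaxIndependent G S → Critical G S) where

      Ω-all-critical : All (Critical G) Ω
      Ω-all-critical = All.tabulate (λ S∈Ω → Ω-critical _ (∈Ω⁻ S∈Ω))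

      core-critical : ∀ {C} → IsCore G C → Critical G C
      core-critical C-core = subst (Critical G) (sym (core≡⋂Ω C-core))
        (foldr-preservesᵇ {P = Critical G} (λ {A B} → Critical-∩ {A} {B})
          (Ω-critical S₀ S₀-max) Ω-all-critical)

      corona-critical : ∀ {K} → IsCorona G K → Critical G K
      corona-critical K-corona = subst (Critical G) (sym (corona≡⋃Ω K-corona))
        (foldr-preservesᵇ {P = Critical G} (λ {A B} → Critical-∪ {A} {B})
          (Ω-critical S₀ S₀-max) Ω-all-critical)

mainTheorem2 : ∀ {n : ℕ} (G : Graph n) → KoenigEgervary G →
    (∀ (C : Subset n) → IsCore G C → Critical G C) ×
    (∀ (K : Subset n) → IsCorona G K → Critical G K)
mainTheorem2 {n} G (α , μ , (S₀ , S₀-max , ∣S₀∣≡α) , (M , M-matching , ∣M∣≡μ , _) , α+μ≡n) =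
  (λ _ → core-critical G S₀-max Ω-critical) , (λ _ → corona-critical G S₀-max Ω-critical)
  where
  Ω-critical : ∀ S → MaxIndependent G S → Critical G S
  Ω-critical S S-max = independent-critical G M-matching (proj₁ S-max) (begin
    ∣ S ∣ + length M  ≡⟨ cong₂ _+_ (trans (maxIndependent-size G S-max S₀-max) ∣S₀∣≡α) ∣M∣≡μ ⟩
    α + μ             ≡⟨ α+μ≡n ⟩
    n                 ∎)
    where open ≡-Reasoning
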